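{- In a core graph, every pair of consecutive vertices on a $5$-hole has at most one common neighbour.
   Context: All graphs are finite and simple. A $5$-hole is an induced cycle of length $5$. For a graph $G$, let $P(G)$ be the polytope in $\mathbb{R}^{V(G)}$ defined by $0\le x_v\le 1$ for every vertex $v$, $x_u+x_v\le 1$ for every edge $uv$, and $\sum_{v\in V(C)}x_v\le (|V(C)|-1)/2$ for every induced odd cycle $C$. $G$ is t-perfect if $P(G)$ equals the convex hull of characteristic vectors of independent sets of $G$, t-imperfect otherwise. If $N(v)$ is an independent set, the t-contraction at $v$ contracts $N(v)\cup\{v\}$ into a single vertex. A t-minor of $G$ is a graph obtained by a sequence of vertex deletions and t-contractions; it is proper if it has fewer vertices than $G$. A graph $G$ is a core graph if neither $G$ nor its complement $\overline{G}$ has a t-imperfect proper t-minor. -}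

module Defs where

open import Data.Nat as ℕ using (ℕ; zero; suc; _%_)
open import Data.Fin using (Fin; zero; suc; toℕ; _≟_)
open import Data.Bool using (Bool; true; false; not; _∧_; _∨_; if_then_else_)
open import Data.Integer using (+_)
open import Data.Rational using (ℚ; 0ℚ; 1ℚ; _+_; _*_; _≤_; _/_)
open import Data.Product using (Σ; _×_; ∃; _,_)
open import Function using (_∘_; _⇔_)
open import Function.Definitions using (Injective)
open import Relation.Binary.PropositionalEquality using (_≡_)
open import Relation.Nullary using (¬_)
open import Relation.Nullary.Decidable using (⌊_⌋)

Graph : ℕ → Set
Graph n = Fin n → Fin n → Bool

Adj : ∀ {n} → Graph n → Fin n → Fin n → Set
Adj G u v = G u v ≡ true

Simple : ∀ {n} → Graph n → Set
Simple G = (∀ u v → G u v ≡ G v u) × (∀ v → G v v ≡ false)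

complement : ∀ {n} → Graph n → Graph n
complement G u v = not (G u v) ∧ not ⌊ u ≟ v ⌋

induced : ∀ {m n} → Graph n → (Fin m → Fin n) → Graph m
induced G e i j = G (e i) (e j)

anyFin : ∀ {n} → (Fin n → Bool) → Bool
anyFin {zero} f = false
anyFin {suc n} f = f zero ∨ anyFin (f ∘ suc)

dist2 : ∀ {n} → Graph n → Fin n → Fin n → Bool
dist2 G v b = not ⌊ b ≟ v ⌋ ∧ not (G v b) ∧ anyFin (λ u → G v u ∧ G u b)

-- vertex v takes over the role of the contracted vertex N(v) ∪ {v}:
-- it becomes adjacent exactly to the vertices outside N[v] having a
-- neighbour in N(v).  Deleting N(v) afterwards yields the t-contraction.
contractAdj : ∀ {n} → Graph n → Fin n → Graph n
contractAdj G v a b =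
  if ⌊ a ≟ v ⌋ then dist2 G v b
  else (if ⌊ b ≟ v ⌋ then dist2 G v a else G a b)

NeighIndep : ∀ {n} → Graph n → Fin n → Set
NeighIndep G v = ∀ u w → Adj G v u → Adj G v w → G u w ≡ false

-- H ≼ G : H is (isomorphic to) a t-minor of G
data _≼_ : ∀ {m n} → Graph m → Graph n → Set where
  ≼-refl : ∀ {n} {G : Graph n} → G ≼ G
  -- deletion of a set of vertices (keep the image of an injection e)
  ≼-del : ∀ {k m n} {H : Graph k} {G : Graph n}
          (e : Fin m → Fin n) → Injective _≡_ _≡_ e →
          H ≼ induced G e → H ≼ G
  ≼-con : ∀ {k m n} {H : Graph k} {G : Graph n} (v : Fin n) →
          NeighIndep G v →
          (e : Fin m → Fin n) → Injective _≡_ _≡_ e →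
          (∀ u → (∃ λ i → e i ≡ u) ⇔ (¬ Adj G v u)) →
          H ≼ induced (contractAdj G v) e → H ≼ G

Σℚ : ∀ {k} → (Fin k → ℚ) → ℚ
Σℚ {zero} f = 0ℚ
Σℚ {suc k} f = f zero + Σℚ (f ∘ suc)

fromℕℚ : ℕ → ℚ
fromℕℚ n = + n / 1

χ : Bool → ℚ
χ true = 1ℚ
χ false = 0ℚ

Consec : ∀ k → .{{_ : ℕ.NonZero k}} → Fin k → Fin k → Set
Consec k i j = suc (toℕ i) % k ≡ toℕ j

InducedCycle : ∀ {n} k → .{{_ : ℕ.NonZero k}} → Graph n → (Fin k → Fin n) → Set
InducedCycle k G c =
  Injective _≡_ _≡_ c ×
  (∀ i j → Adj G (c i) (c j) ⇔ (Consec k i j Data.Sum.⊎ Consec k j i))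
  where import Data.Sum

-- odd cycles have length 2j+3
oddLen : ℕ → ℕ
oddLen j = suc (suc (suc (2 ℕ.* j)))

InP : ∀ {n} → Graph n → (Fin n → ℚ) → Set
InP G x =
  (∀ v → (0ℚ ≤ x v) × (x v ≤ 1ℚ)) ×
  (∀ u v → Adj G u v → x u + x v ≤ 1ℚ) ×
  (∀ j (c : Fin (oddLen j) → Fin _) → InducedCycle (oddLen j) G c →
     Σℚ (x ∘ c) ≤ fromℕℚ (suc j))

Independent : ∀ {n} → Graph n → (Fin n → Bool) → Set
Independent G S = ∀ u v → S u ≡ true → S v ≡ true → G u v ≡ false

InStab : ∀ {n} → Graph n → (Fin n → ℚ) → Set
InStab {n} G x =
  Σ ℕ λ m → Σ (Fin m → ℚ) λ λs → Σ (Fin m → Fin n → Bool) λ S →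
    (∀ i → 0ℚ ≤ λs i) × (Σℚ λs ≡ 1ℚ) × (∀ i → Independent G (S i)) ×
    (∀ v → x v ≡ Σℚ (λ i → λs i * χ (S i v)))

TPerfect : ∀ {n} → Graph n → Set
TPerfect G = ∀ x → (InP G x → InStab G x) × (InStab G x → InP G x)

TImperfect : ∀ {n} → Graph n → Set
TImperfect G = ¬ TPerfect G

HasTImperfectProperTMinor : ∀ {n} → Graph n → Set
HasTImperfectProperTMinor {n} G =
  Σ ℕ λ m → Σ (Graph m) λ H → (m ℕ.< n) × (H ≼ G) × TImperfect H

CoreGraph : ∀ {n} → Graph n → Set
CoreGraph G = ¬ HasTImperfectProperTMinor G × ¬ HasTImperfectProperTMinor (complement G)

Hole5 : ∀ {n} → Graph n → (Fin 5 → Fin n) → Set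
Hole5 G c = InducedCycle 5 G c

{-# OPTIONS --safe #-}
module Submission where

-- Let w ≠ w′ be common neighbours of two consecutive vertices c₀, c₁ of a 5-hole.
-- If w is adjacent to c₂ or c₄, then the hole together with w has K₄ as a t-minor
-- (a t-contraction at a suitable hole vertex), or it is the wheel W₅; both K₄ and
-- W₅ are t-imperfect because the all-⅓ vector lies in P but violates a stable-set
-- inequality.  So neither w nor w′ sees c₂ or c₄.  Then {w, w′, c₀, c₁} induces K₄
-- in G when w and w′ are adjacent, and {w, w′, c₂, c₄} induces K₄ in the complement
-- otherwise.  All facts about these fixed small graphs are decided by computation.

open import Defs
open import Algebra.Bundles using (CommutativeRing)
open import Data.Bool using (Bool; true; false; not; _∧_; _∨_; if_then_else_)
import Data.Bool.Properties as Bool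
open import Data.Empty using (⊥-elim)
open import Data.Fin using (Fin; zero; suc; toℕ; _≟_; #_)
open import Data.Fin.Properties using (all?; any?; injective⇒≤)
open import Data.Fin.Subset using (Subset)
open import Data.Fin.Subset.Properties using (anySubset?)
open import Data.Integer as ℤ using (+_)
import Data.Integer.Properties as ℤ
open import Data.Nat as ℕ using (ℕ; suc; _%_)
open import Data.Nat.DivMod using (_mod_)
import Data.Nat.Properties as ℕ
open import Data.Product using (Σ-syntax; ∃; _×_; _,_; proj₁; proj₂)
open import Data.Rational using (ℚ; 0ℚ; 1ℚ; _+_; _*_; _≤_; _<_; _/_; nonNegative; toℚᵘ)
open import Data.Rational.Properties
  using ( ≤-refl; <-irrefl; <-≤-trans; _≤?_; _<?_; +-assoc; +-mono-≤; *-assoc; *-comm; *-identityˡ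
        ; *-monoˡ-≤-nonNeg; +-*-commutativeRing; toℚᵘ-injective; toℚᵘ-fromℚᵘ; toℚᵘ-homo-+; module ≤-Reasoning)
import Data.Rational.Unnormalised as ℚᵘ
import Data.Rational.Unnormalised.Properties as ℚᵘ
open import Data.Sum using (_⊎_; inj₁; inj₂; [_,_]′)
import Data.Sum as Sum
open import Data.Vec using (lookup; tabulate)
open import Data.Vec.Properties using (lookup∘tabulate)
open import Data.Vec.Functional using (_∷_; [])
open import Function using (_∘_; _⇔_; Equivalence; mk⇔)
open import Function.Definitions using (Injective)
open import Relation.Binary.PropositionalEquality using (_≡_; _≢_; refl; sym; trans; cong; cong₂; subst)
open import Relation.Nullary using (¬_; Dec; yes; no; ¬?)
open import Relation.Nullary.Decidable
  using (⌊_⌋; True; toWitness; from-yes; map′; decidable-stable; _×-dec_; _→-dec_; _⊎-dec_)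

open import Algebra.Properties.Semiring.Sum (CommutativeRing.semiring +-*-commutativeRing)
  using (sum; sum-cong-≗; ∑-comm; *-distribˡ-sum; *-distribʳ-sum)

Σℚ≡sum : ∀ {k} (f : Fin k → ℚ) → Σℚ f ≡ sum f
Σℚ≡sum {ℕ.zero} f = refl
Σℚ≡sum {suc k}  f = cong (λ s → f zero + s) (Σℚ≡sum (f ∘ suc))

sum-mono-≤ : ∀ {k} {f g : Fin k → ℚ} → (∀ i → f i ≤ g i) → sum f ≤ sum g
sum-mono-≤ {ℕ.zero} f≤g = ≤-refl
sum-mono-≤ {suc k}  f≤g = +-mono-≤ (f≤g zero) (sum-mono-≤ (f≤g ∘ suc))

weight : ∀ {n} → (Fin n → ℚ) → (Fin n → Bool) → ℚ
weight a S = Σℚ λ v → a v * χ (S v)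

weight-cong : ∀ {n} (a : Fin n → ℚ) {S T : Fin n → Bool} →
  (∀ v → S v ≡ T v) → weight a S ≡ weight a T
weight-cong a {S} {T} S≗T =
  trans (Σℚ≡sum (λ v → a v * χ (S v)))
        (trans (sum-cong-≗ (λ v → cong (λ b → a v * χ b) (S≗T v))) (sym (Σℚ≡sum (λ v → a v * χ (T v)))))

InStab-valid : ∀ {n} (G : Graph n) (a : Fin n → ℚ) (b : ℚ) →
  (∀ S → Independent G S → weight a S ≤ b) →
  ∀ {x} → InStab G x → Σℚ (λ v → a v * x v) ≤ b
InStab-valid {n} G a b bound {x} (m , λs , S , λs≥0 , Σλs≡1 , indep , x≡) = begin
  Σℚ (λ v → a v * x v)                ≡⟨ Σℚ≡sum (λ v → a v * x v) ⟩
  sum (λ v → a v * x v)               ≡⟨ sum-cong-≗ expand ⟩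
  sum (λ v → sum (λ i → a v * μ i v)) ≡⟨ ∑-comm (λ v i → a v * μ i v) ⟩
  sum (λ i → sum (λ v → a v * μ i v)) ≡⟨ sum-cong-≗ collect ⟨
  sum (λ i → λs i * weight a (S i))   ≤⟨ sum-mono-≤ scaled-bound ⟩
  sum (λ i → λs i * b)                ≡⟨ *-distribʳ-sum b λs ⟨
  sum λs * b                          ≡⟨ cong (_* b) (trans (sym (Σℚ≡sum λs)) Σλs≡1) ⟩
  1ℚ * b                              ≡⟨ *-identityˡ b ⟩
  b                                   ∎
  where
  open ≤-Reasoning
  μ : Fin m → Fin n → ℚ
  μ i v = λs i * χ (S i v)
  expand : ∀ v → a v * x v ≡ sum (λ i → a v * μ i v)
  expand v = trans (cong (a v *_) (trans (x≡ v) (Σℚ≡sum (λ i → μ i v))))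
                   (*-distribˡ-sum (a v) (λ i → μ i v))
  swap : ∀ p q r → p * (q * r) ≡ q * (p * r)
  swap p q r = trans (sym (*-assoc p q r)) (trans (cong (_* r) (*-comm p q)) (*-assoc q p r))
  scaled-bound : ∀ i → λs i * weight a (S i) ≤ λs i * b
  scaled-bound i = *-monoˡ-≤-nonNeg (λs i) {{nonNegative (λs≥0 i)}} (bound (S i) (indep i))
  collect : ∀ i → λs i * weight a (S i) ≡ sum (λ v → a v * μ i v)
  collect i = trans (cong (λs i *_) (Σℚ≡sum (λ v → a v * χ (S i v))))
                    (trans (*-distribˡ-sum (λs i) (λ v → a v * χ (S i v)))
                           (sum-cong-≗ λ v → swap (λs i) (a v) (χ (S i v))))

fromℕℚ-suc : ∀ n → fromℕℚ (suc n) ≡ 1ℚ + fromℕℚ n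
fromℕℚ-suc n = toℚᵘ-injective (begin-equality
  toℚᵘ (fromℕℚ (suc n))           ≃⟨ toℚᵘ-fromℚᵘ (ℚᵘ.mkℚᵘ (+ suc n) 0) ⟩
  ℚᵘ.mkℚᵘ (+ suc n) 0             ≃⟨ ℚᵘ.*≡* (trans (ℤ.*-identityʳ (+ suc n)) (sym cross-multiplied)) ⟩
  ℚᵘ.1ℚᵘ ℚᵘ.+ ℚᵘ.mkℚᵘ (+ n) 0     ≃⟨ ℚᵘ.+-congʳ ℚᵘ.1ℚᵘ (toℚᵘ-fromℚᵘ (ℚᵘ.mkℚᵘ (+ n) 0)) ⟨
  toℚᵘ 1ℚ ℚᵘ.+ toℚᵘ (fromℕℚ n)   ≃⟨ toℚᵘ-homo-+ 1ℚ (fromℕℚ n) ⟨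
  toℚᵘ (1ℚ + fromℕℚ n)           ∎)
  where
  open ℚᵘ.≤-Reasoning
  cross-multiplied : (+ 1 ℤ.* + 1 ℤ.+ + n ℤ.* + 1) ℤ.* + 1 ≡ + suc n
  cross-multiplied = trans (ℤ.*-identityʳ _) (cong (ℤ._+_ (+ 1)) (ℤ.*-identityʳ (+ n)))

⅓ : ℚ
⅓ = + 1 / 3

⅓-oddCycle-sum : ∀ j → Σℚ {oddLen j} (λ _ → ⅓) ≤ fromℕℚ (suc j)
⅓-oddCycle-sum ℕ.zero = from-yes (⅓ + (⅓ + (⅓ + 0ℚ)) ≤? 1ℚ)
⅓-oddCycle-sum (suc j) = begin
  Σℚ {oddLen (suc j)} (λ _ → ⅓)      ≡⟨ cong (λ k → Σℚ {3 ℕ.+ k} (λ _ → ⅓)) (ℕ.*-suc 2 j) ⟩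
  ⅓ + (⅓ + Σℚ {oddLen j} (λ _ → ⅓))  ≡⟨ +-assoc ⅓ ⅓ (Σℚ {oddLen j} (λ _ → ⅓)) ⟨
  (⅓ + ⅓) + Σℚ {oddLen j} (λ _ → ⅓)  ≤⟨ +-mono-≤ (from-yes (⅓ + ⅓ ≤? 1ℚ)) (⅓-oddCycle-sum j) ⟩
  1ℚ + fromℕℚ (suc j)                ≡⟨ fromℕℚ-suc (suc j) ⟨
  fromℕℚ (suc (suc j))               ∎
  where open ≤-Reasoning

⅓∈P : ∀ {n} (G : Graph n) → InP G (λ _ → ⅓)
⅓∈P G =
  (λ _ → from-yes (0ℚ ≤? ⅓) , from-yes (⅓ ≤? 1ℚ)) ,
  (λ _ _ _ → from-yes (⅓ + ⅓ ≤? 1ℚ)) ,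
  (λ j _ _ → ⅓-oddCycle-sum j)

tImperfect-by-⅓ : ∀ {n} (G : Graph n) (a : Fin n → ℚ) (b : ℚ) →
  (∀ S → Independent G S → weight a S ≤ b) → b < Σℚ (λ v → a v * ⅓) → TImperfect G
tImperfect-by-⅓ G a b bound b<a⅓ tPerfect =
  <-irrefl refl (<-≤-trans b<a⅓ (InStab-valid G a b bound (proj₁ (tPerfect _) (⅓∈P G))))

infix 4 _≐_

_≐_ : ∀ {n} → Graph n → Graph n → Set
G ≐ H = ∀ u v → G u v ≡ H u v

≐-sym : ∀ {n} {G H : Graph n} → G ≐ H → H ≐ G
≐-sym G≐H u v = sym (G≐H u v)

induced-resp : ∀ {m n} {G H : Graph n} → G ≐ H → (e : Fin m → Fin n) → induced G e ≐ induced H e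
induced-resp G≐H e u v = G≐H (e u) (e v)

complement-resp : ∀ {n} {G H : Graph n} → G ≐ H → complement G ≐ complement H
complement-resp G≐H u v = cong (λ b → not b ∧ not ⌊ u ≟ v ⌋) (G≐H u v)

InducedCycle-resp : ∀ {n k} .{{_ : ℕ.NonZero k}} {G H : Graph n} {c : Fin k → Fin n} →
  G ≐ H → InducedCycle k G c → InducedCycle k H c
InducedCycle-resp {c = c} G≐H (c-inj , adj⇔) =
  c-inj , λ i j → subst (λ b → b ≡ true ⇔ _) (G≐H (c i) (c j)) (adj⇔ i j)

InP-resp : ∀ {n} {G H : Graph n} {x} → G ≐ H → InP G x → InP H x
InP-resp G≐H (bounds , edges , cycles) =
  bounds ,
  (λ u v uv → edges u v (trans (G≐H u v) uv)) ,
  (λ j c isCycle → cycles j c (InducedCycle-resp (≐-sym G≐H) isCycle))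

InStab-resp : ∀ {n} {G H : Graph n} {x} → G ≐ H → InStab G x → InStab H x
InStab-resp G≐H (m , λs , S , λs≥0 , Σλs≡1 , indep , x≡) =
  m , λs , S , λs≥0 , Σλs≡1 , (λ i u v Su Sv → trans (sym (G≐H u v)) (indep i u v Su Sv)) , x≡

TImperfect-resp : ∀ {n} {G H : Graph n} → G ≐ H → TImperfect G → TImperfect H
TImperfect-resp G≐H tImperfect tPerfect = tImperfect λ x →
  (λ x∈P → InStab-resp (≐-sym G≐H) (proj₁ (tPerfect x) (InP-resp G≐H x∈P))) ,
  (λ x∈Stab → InP-resp (≐-sym G≐H) (proj₂ (tPerfect x) (InStab-resp G≐H x∈Stab)))

anyFin-cong : ∀ {k} {f g : Fin k → Bool} → (∀ i → f i ≡ g i) → anyFin f ≡ anyFin g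
anyFin-cong {ℕ.zero} f≗g = refl
anyFin-cong {suc k} f≗g = cong₂ _∨_ (f≗g zero) (anyFin-cong (f≗g ∘ suc))

dist2-resp : ∀ {n} {G H : Graph n} → G ≐ H → ∀ v b → dist2 G v b ≡ dist2 H v b
dist2-resp G≐H v b =
  cong₂ (λ x y → not ⌊ b ≟ v ⌋ ∧ not x ∧ y) (G≐H v b)
        (anyFin-cong λ u → cong₂ _∧_ (G≐H v u) (G≐H u b))

contractAdj-resp : ∀ {n} {G H : Graph n} → G ≐ H → ∀ v → contractAdj G v ≐ contractAdj H v
contractAdj-resp G≐H v a b =
  cong₂ (λ x y → if ⌊ a ≟ v ⌋ then x else y) (dist2-resp G≐H v b)
        (cong₂ (λ x y → if ⌊ b ≟ v ⌋ then x else y) (dist2-resp G≐H v a) (G≐H a b))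

NeighIndep-resp : ∀ {n} {G H : Graph n} {v} → G ≐ H → NeighIndep G v → NeighIndep H v
NeighIndep-resp {v = v} G≐H indep u w vu vw =
  trans (sym (G≐H u w)) (indep u w (trans (G≐H v u) vu) (trans (G≐H v w) vw))

≼-resp : ∀ {k n} {H : Graph k} {G G′ : Graph n} → G ≐ G′ → H ≼ G′ →
  Σ[ H′ ∈ Graph k ] H′ ≐ H × H′ ≼ G
≼-resp {G = G} G≐G′ ≼-refl = G , G≐G′ , ≼-refl
≼-resp G≐G′ (≼-del e e-inj H≼) =
  let H′ , H′≐H , H′≼ = ≼-resp (induced-resp G≐G′ e) H≼
  in  H′ , H′≐H , ≼-del e e-inj H′≼
≼-resp G≐G′ (≼-con v indep e e-inj e-onto H≼) =
  let H′ , H′≐H , H′≼ = ≼-resp (induced-resp (contractAdj-resp G≐G′ v) e) H≼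
  in  H′ , H′≐H , ≼-con v (NeighIndep-resp (≐-sym G≐G′) indep) e e-inj
                    (λ u → subst (λ b → _ ⇔ (¬ b ≡ true)) (sym (G≐G′ v u)) (e-onto u)) H′≼

⌊⌋-cong : ∀ {A B : Set} (a? : Dec A) (b? : Dec B) → (A → B) → (B → A) → ⌊ a? ⌋ ≡ ⌊ b? ⌋
⌊⌋-cong (yes _) (yes _) _   _   = refl
⌊⌋-cong (no _)  (no _)  _   _   = refl
⌊⌋-cong (yes a) (no ¬b) a→b _   = ⊥-elim (¬b (a→b a))
⌊⌋-cong (no ¬a) (yes b) _   b→a = ⊥-elim (¬a (b→a b))

⌊⌋-unique : ∀ {P : Set} {x : Bool} → (x ≡ true ⇔ P) → (p? : Dec P) → x ≡ ⌊ p? ⌋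
⌊⌋-unique {x = true}  _     (yes _)  = refl
⌊⌋-unique {x = true}  x⇔P   (no ¬p)  = ⊥-elim (¬p (Equivalence.to x⇔P refl))
⌊⌋-unique {x = false} x⇔P   (yes p)  with Equivalence.from x⇔P p
... | ()
⌊⌋-unique {x = false} _     (no _)   = refl

induced-complement : ∀ {m n} (G : Graph n) {e : Fin m → Fin n} → Injective _≡_ _≡_ e →
  induced (complement G) e ≐ complement (induced G e)
induced-complement G {e} e-inj u v =
  cong (λ b → not (G (e u) (e v)) ∧ not b) (⌊⌋-cong (e u ≟ e v) (u ≟ v) e-inj (cong e))

addVertex : ∀ {m} → Graph m → (Fin m → Bool) → Graph (suc m)
addVertex K r = (false ∷ r) ∷ λ u → r u ∷ K u

induced-addVertex : ∀ {m n} {G : Graph n} → Simple G → {f : Fin m → Fin n} {K : Graph m} →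
  induced G f ≐ K → ∀ {x r} → (∀ u → G (f u) x ≡ r u) → induced G (x ∷ f) ≐ addVertex K r
induced-addVertex (_ , irrefl) _ {x} _ zero zero = irrefl x
induced-addVertex (symmetric , _) {f} _ {x} row zero (suc v) = trans (symmetric x (f v)) (row v)
induced-addVertex _ _ row (suc u) zero = row u
induced-addVertex _ f≐K _ (suc u) (suc v) = f≐K u v

∷-injective : ∀ {m n} {f : Fin m → Fin n} {x} → Injective _≡_ _≡_ f → (∀ u → f u ≢ x) →
  Injective _≡_ _≡_ (x ∷ f)
∷-injective f-inj x∉f {zero}  {zero}  _ = refl
∷-injective f-inj x∉f {zero}  {suc v} x≡fv = ⊥-elim (x∉f v (sym x≡fv))
∷-injective f-inj x∉f {suc u} {zero}  fu≡x = ⊥-elim (x∉f u fu≡x)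
∷-injective f-inj x∉f {suc u} {suc v} fu≡fv = cong suc (f-inj fu≡fv)

TImperfectMinor : ∀ {m} → Graph m → ℕ → Set
TImperfectMinor K k = Σ[ H ∈ Graph k ] H ≼ K × TImperfect H

tImperfectMinor-transfer : ∀ {k m n} {G : Graph n} {K : Graph m} {e : Fin m → Fin n} →
  Injective _≡_ _≡_ e → induced G e ≐ K → k ℕ.< n → TImperfectMinor K k → HasTImperfectProperTMinor G
tImperfectMinor-transfer {k} {e = e} e-inj e≐K k<n (H , H≼K , tImperfect) =
  let H′ , H′≐H , H′≼ = ≼-resp e≐K H≼K
  in  k , H′ , k<n , ≼-del e e-inj H′≼ , TImperfect-resp (≐-sym H′≐H) tImperfect

_≐?_ : ∀ {n} (G H : Graph n) → Dec (G ≐ H)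
G ≐? H = all? λ u → all? λ v → G u v Bool.≟ H u v

independent? : ∀ {n} (G : Graph n) S → Dec (Independent G S)
independent? G S = all? λ u → all? λ v → S u Bool.≟ true →-dec S v Bool.≟ true →-dec G u v Bool.≟ false

allSubsets? : ∀ {n} {P : Subset n → Set} → (∀ S → Dec (P S)) → Dec (∀ S → P S)
allSubsets? P? = map′ (λ ∄¬P S → decidable-stable (P? S) (λ ¬PS → ∄¬P (S , ¬PS)))
                      (λ ∀P (S , ¬PS) → ¬PS (∀P S))
                      (¬? (anySubset? (¬? ∘ P?)))

stableBound? : ∀ {n} (G : Graph n) a b → Dec (∀ S → Independent G S → weight a S ≤ b)
stableBound? G a b =
  map′ fromSubsets (λ bound S → bound (lookup S))
       (allSubsets? λ S → independent? G (lookup S) →-dec weight a (lookup S) ≤? b)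
  where
  fromSubsets : (∀ (S : Subset _) → Independent G (lookup S) → weight a (lookup S) ≤ b) →
                ∀ S → Independent G S → weight a S ≤ b
  fromSubsets bound S S-indep =
    subst (_≤ b) (weight-cong a (lookup∘tabulate S))
      (bound (tabulate S) λ u v Su Sv →
        S-indep u v (trans (sym (lookup∘tabulate S u)) Su) (trans (sym (lookup∘tabulate S v)) Sv))

_⇔?_ : ∀ {A B : Set} → Dec A → Dec B → Dec (A ⇔ B)
a? ⇔? b? = map′ (λ (to , from) → mk⇔ to from) (λ A⇔B → Equivalence.to A⇔B , Equivalence.from A⇔B)
                ((a? →-dec b?) ×-dec (b? →-dec a?))

neighIndep? : ∀ {n} (G : Graph n) v → Dec (NeighIndep G v)
neighIndep? G v = all? λ u → all? λ w → G v u Bool.≟ true →-dec G v w Bool.≟ true →-dec G u w Bool.≟ false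

injective? : ∀ {m n} (e : Fin m → Fin n) → Dec (Injective _≡_ _≡_ e)
injective? e = map′ (λ inj {u} {v} → inj u v) (λ inj u v → inj)
                    (all? λ u → all? λ v → e u ≟ e v →-dec u ≟ v)

TContraction : ∀ {k m} → Graph m → Fin m → (Fin k → Fin m) → Set
TContraction K v e = NeighIndep K v × Injective _≡_ _≡_ e × (∀ u → (∃ λ i → e i ≡ u) ⇔ (¬ Adj K v u))

tContraction? : ∀ {k m} (K : Graph m) v (e : Fin k → Fin m) → Dec (TContraction K v e)
tContraction? K v e = neighIndep? K v ×-dec injective? e ×-dec
                      all? λ u → any? (λ i → e i ≟ u) ⇔? ¬? (K v u Bool.≟ true)

tContraction-≼ : ∀ {k m} {K : Graph m} {v} {e : Fin k → Fin m} →
  TContraction K v e → induced (contractAdj K v) e ≼ K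
tContraction-≼ {v = v} {e} (indep , e-inj , e-onto) = ≼-con v indep e e-inj e-onto ≼-refl

K4 : Graph 4
K4 u v = not ⌊ u ≟ v ⌋

K4-tImperfect : TImperfect K4
K4-tImperfect =
  tImperfect-by-⅓ K4 a 1ℚ (from-yes (stableBound? K4 a 1ℚ)) (from-yes (1ℚ <? Σℚ λ v → a v * ⅓))
  where
  a : Fin 4 → ℚ
  a _ = 1ℚ

consec? : ∀ {k} .{{_ : ℕ.NonZero k}} (i j : Fin k) → Dec (Consec k i j)
consec? {k} i j = suc (toℕ i) % k ℕ.≟ toℕ j

C5 : Graph 5
C5 u v = ⌊ consec? u v ⊎-dec consec? v u ⌋

-- Vertex 0 is a new vertex w adjacent to c₀ and c₁ and, as b₂ b₃ b₄ say, to c₂ c₃ c₄;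
-- vertex suc k is the hole vertex c k.
C5⁺ : Bool → Bool → Bool → Graph 6
C5⁺ b₂ b₃ b₄ = addVertex C5 (true ∷ true ∷ b₂ ∷ b₃ ∷ b₄ ∷ [])

W5 : Graph 6
W5 = C5⁺ true true true

W5-tImperfect : TImperfect W5
W5-tImperfect =
  tImperfect-by-⅓ W5 a 2ℚ (from-yes (stableBound? W5 a 2ℚ)) (from-yes (2ℚ <? Σℚ λ v → a v * ⅓))
  where
  2ℚ : ℚ
  2ℚ = fromℕℚ 2
  a : Fin 6 → ℚ
  a = 2ℚ ∷ λ _ → 1ℚ

K4-by-contraction : ∀ {m} {K : Graph m} v (e : Fin 4 → Fin m) →
  {True (tContraction? K v e ×-dec induced (contractAdj K v) e ≐? K4)} → TImperfectMinor K 4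
K4-by-contraction v e {certified} =
  let contraction , contracted≐K4 = toWitness certified
  in  _ , tContraction-≼ contraction , TImperfect-resp (≐-sym contracted≐K4) K4-tImperfect

K4-by-deletion : ∀ {m} {K : Graph m} (e : Fin 4 → Fin m) →
  {True (injective? e ×-dec induced K e ≐? K4)} → TImperfectMinor K 4
K4-by-deletion {K = K} e {certified} =
  let e-inj , induced≐K4 = toWitness certified
  in  induced K e , ≼-del e e-inj ≼-refl , TImperfect-resp (≐-sym induced≐K4) K4-tImperfect

-- If w sees c₂ or c₄ but not the whole hole, then w and two consecutive hole vertices
-- form a triangle, and t-contracting a suitable hole vertex that w misses creates a
-- fourth vertex adjacent to all three.
C5⁺-minor : ∀ b₂ b₃ b₄ → (b₂ ≡ false × b₄ ≡ false) ⊎ (Σ[ k ∈ ℕ ] k ℕ.≤ 6 × TImperfectMinor (C5⁺ b₂ b₃ b₄) k)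
C5⁺-minor false _     false = inj₁ (refl , refl)
C5⁺-minor true  true  true  = inj₂ (6 , ℕ.≤-refl , W5 , ≼-refl , W5-tImperfect)
C5⁺-minor true  false false = inj₂ (4 , ℕ.m≤m+n 4 2 , K4-by-contraction (# 4) (# 0 ∷ # 1 ∷ # 2 ∷ # 4 ∷ []))
C5⁺-minor true  true  false = inj₂ (4 , ℕ.m≤m+n 4 2 , K4-by-contraction (# 5) (# 0 ∷ # 2 ∷ # 3 ∷ # 5 ∷ []))
C5⁺-minor true  false true  = inj₂ (4 , ℕ.m≤m+n 4 2 , K4-by-contraction (# 4) (# 0 ∷ # 1 ∷ # 2 ∷ # 4 ∷ []))
C5⁺-minor false _     true  = inj₂ (4 , ℕ.m≤m+n 4 2 , K4-by-contraction (# 3) (# 0 ∷ # 1 ∷ # 3 ∷ # 5 ∷ []))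

-- Vertex 0 is w′, vertex 1 is w; both see c₀, c₁ and miss c₂, c₄.
C5⁺⁺ : Bool → Bool → Bool → Graph 7
C5⁺⁺ b₃ d₃ t = addVertex (C5⁺ false b₃ false) (t ∷ true ∷ true ∷ false ∷ d₃ ∷ false ∷ [])

-- {w′, w, c₀, c₁} is a clique when w ~ w′; otherwise {w′, w, c₂, c₄} is a clique of the complement.
C5⁺⁺-minor : ∀ b₃ d₃ t → TImperfectMinor (C5⁺⁺ b₃ d₃ t) 4 ⊎ TImperfectMinor (complement (C5⁺⁺ b₃ d₃ t)) 4
C5⁺⁺-minor _ _ true  = inj₁ (K4-by-deletion (# 0 ∷ # 1 ∷ # 2 ∷ # 3 ∷ []))
C5⁺⁺-minor _ _ false = inj₂ (K4-by-deletion (# 0 ∷ # 1 ∷ # 4 ∷ # 6 ∷ []))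

hole≐C5 : ∀ {n} {G : Graph n} {c} → Hole5 G c → induced G c ≐ C5
hole≐C5 (_ , adj⇔) u v = ⌊⌋-unique (adj⇔ u v) _

rotate : Fin 5 → Fin 5 → Fin 5
rotate i k = (toℕ i ℕ.+ toℕ k) mod 5

rotate-zero : ∀ i → rotate i zero ≡ i
rotate-zero = from-yes (all? λ i → rotate i zero ≟ i)

rotate-consec : ∀ i j → Consec 5 i j → rotate i (suc zero) ≡ j
rotate-consec = from-yes (all? λ i → all? λ j → consec? i j →-dec rotate i (suc zero) ≟ j)

rotate-injective : ∀ i → Injective _≡_ _≡_ (rotate i)
rotate-injective = from-yes (all? λ i → injective? (rotate i))

C5-rotate : ∀ i → induced C5 (rotate i) ≐ C5
C5-rotate = from-yes (all? λ i → induced C5 (rotate i) ≐? C5)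

C5-no-common-neighbour : ∀ k → ¬ (C5 (# 0) k ≡ true × C5 (# 1) k ≡ true)
C5-no-common-neighbour = from-yes (all? λ k → ¬? (C5 (# 0) k Bool.≟ true ×-dec C5 (# 1) k Bool.≟ true))

module _ {n} {G : Graph n} {c : Fin 5 → Fin n} where

  neighbour-row : ∀ {w b₂ b₃ b₄} →
    Adj G (c (# 0)) w → Adj G (c (# 1)) w → G (c (# 2)) w ≡ b₂ → G (c (# 3)) w ≡ b₃ → G (c (# 4)) w ≡ b₄ →
    ∀ u → G (c u) w ≡ (true ∷ true ∷ b₂ ∷ b₃ ∷ b₄ ∷ []) u
  neighbour-row c₀w _   _   _   _   zero                         = c₀w
  neighbour-row _   c₁w _   _   _   (suc zero)                   = c₁w
  neighbour-row _   _   c₂w _   _   (suc (suc zero))             = c₂w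
  neighbour-row _   _   _   c₃w _   (suc (suc (suc zero)))       = c₃w
  neighbour-row _   _   _   _   c₄w (suc (suc (suc (suc zero)))) = c₄w

  module _ (c≐C5 : induced G c ≐ C5) where

    off-hole : ∀ {w} → Adj G (c (# 0)) w → Adj G (c (# 1)) w → ∀ k → c k ≢ w
    off-hole c₀w c₁w k refl =
      C5-no-common-neighbour k (trans (sym (c≐C5 (# 0) k)) c₀w , trans (sym (c≐C5 (# 1) k)) c₁w)

    module _ (simple : Simple G) where

      common-neighbour-minor⊎misses-c₂c₄ : Injective _≡_ _≡_ c → 6 ℕ.< n →
        ∀ {w} → Adj G (c (# 0)) w → Adj G (c (# 1)) w →
        HasTImperfectProperTMinor G ⊎ (G (c (# 2)) w ≡ false × G (c (# 4)) w ≡ false)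
      common-neighbour-minor⊎misses-c₂c₄ c-inj 6<n {w} c₀w c₁w
        with C5⁺-minor (G (c (# 2)) w) (G (c (# 3)) w) (G (c (# 4)) w)
      ... | inj₁ misses = inj₂ misses
      ... | inj₂ (k , k≤6 , minor) =
        inj₁ (tImperfectMinor-transfer (∷-injective c-inj (off-hole c₀w c₁w))
                (induced-addVertex simple c≐C5 (neighbour-row c₀w c₁w refl refl refl))
                (ℕ.≤-<-trans k≤6 6<n) minor)

      two-common-neighbours-minor : ∀ {w w′} → Injective _≡_ _≡_ (w′ ∷ w ∷ c) →
        Adj G (c (# 0)) w → Adj G (c (# 1)) w → G (c (# 2)) w ≡ false → G (c (# 4)) w ≡ false →
        Adj G (c (# 0)) w′ → Adj G (c (# 1)) w′ → G (c (# 2)) w′ ≡ false → G (c (# 4)) w′ ≡ false →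
        HasTImperfectProperTMinor G ⊎ HasTImperfectProperTMinor (complement G)
      two-common-neighbours-minor {w} {w′} e-inj c₀w c₁w c₂w c₄w c₀w′ c₁w′ c₂w′ c₄w′ =
        Sum.map (tImperfectMinor-transfer e-inj e≐C5⁺⁺ 4<n)
                (tImperfectMinor-transfer e-inj complement≐ 4<n)
                (C5⁺⁺-minor (G (c (# 3)) w) (G (c (# 3)) w′) (G w w′))
        where
        4<n : 4 ℕ.< n
        4<n = ℕ.≤-trans (ℕ.m≤m+n 5 2) (injective⇒≤ e-inj)
        row : ∀ u → G ((w ∷ c) u) w′ ≡ (G w w′ ∷ true ∷ true ∷ false ∷ G (c (# 3)) w′ ∷ false ∷ []) u
        row zero    = refl
        row (suc u) = neighbour-row c₀w′ c₁w′ c₂w′ refl c₄w′ u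
        e≐C5⁺⁺ : induced G (w′ ∷ w ∷ c) ≐ C5⁺⁺ (G (c (# 3)) w) (G (c (# 3)) w′) (G w w′)
        e≐C5⁺⁺ = induced-addVertex simple (induced-addVertex simple c≐C5 (neighbour-row c₀w c₁w c₂w refl c₄w)) row
        complement≐ : induced (complement G) (w′ ∷ w ∷ c) ≐
                      complement (C5⁺⁺ (G (c (# 3)) w) (G (c (# 3)) w′) (G w w′))
        complement≐ u v = trans (induced-complement G e-inj u v) (complement-resp e≐C5⁺⁺ u v)

      distinct-common-neighbours-minor : Injective _≡_ _≡_ c → ∀ {w w′} → w ≢ w′ →
        Adj G (c (# 0)) w → Adj G (c (# 1)) w → Adj G (c (# 0)) w′ → Adj G (c (# 1)) w′ →
        HasTImperfectProperTMinor G ⊎ HasTImperfectProperTMinor (complement G)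
      distinct-common-neighbours-minor c-inj {w} {w′} w≢w′ c₀w c₁w c₀w′ c₁w′ =
        combine (common-neighbour-minor⊎misses-c₂c₄ c-inj 6<n c₀w c₁w)
                (common-neighbour-minor⊎misses-c₂c₄ c-inj 6<n c₀w′ c₁w′)
        where
        e-inj : Injective _≡_ _≡_ (w′ ∷ w ∷ c)
        e-inj = ∷-injective (∷-injective c-inj (off-hole c₀w c₁w)) λ where
          zero    → w≢w′
          (suc k) → off-hole c₀w′ c₁w′ k
        6<n : 6 ℕ.< n
        6<n = injective⇒≤ e-inj
        combine : HasTImperfectProperTMinor G ⊎ (G (c (# 2)) w ≡ false × G (c (# 4)) w ≡ false) →
                  HasTImperfectProperTMinor G ⊎ (G (c (# 2)) w′ ≡ false × G (c (# 4)) w′ ≡ false) →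
                  HasTImperfectProperTMinor G ⊎ HasTImperfectProperTMinor (complement G)
        combine (inj₁ minor)       _                    = inj₁ minor
        combine (inj₂ _)           (inj₁ minor)         = inj₁ minor
        combine (inj₂ (c₂w , c₄w)) (inj₂ (c₂w′ , c₄w′)) =
          two-common-neighbours-minor e-inj c₀w c₁w c₂w c₄w c₀w′ c₁w′ c₂w′ c₄w′

proposition7 : ∀ (n : ℕ) (G : Graph n) → Simple G → CoreGraph G →
    ∀ (c : Fin 5 → Fin n) → Hole5 G c →
    ∀ (i j : Fin 5) → Consec 5 i j →
    ∀ (w w′ : Fin n) →
    Adj G (c i) w → Adj G (c j) w → Adj G (c i) w′ → Adj G (c j) w′ →
    w ≡ w′
proposition7 n G simple core c hole i j i→j w w′ cᵢw cⱼw cᵢw′ cⱼw′ =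
  decidable-stable (w ≟ w′) λ w≢w′ →
    [ proj₁ core , proj₂ core ]′
      (distinct-common-neighbours-minor {G = G} {c′} c′≐C5 simple c′-inj w≢w′
         (at₀ cᵢw) (at₁ cⱼw) (at₀ cᵢw′) (at₁ cⱼw′))
  where
  c′ : Fin 5 → Fin n
  c′ = c ∘ rotate i
  c′≐C5 : induced G c′ ≐ C5
  c′≐C5 u v = trans (hole≐C5 {G = G} hole (rotate i u) (rotate i v)) (C5-rotate i u v)
  c′-inj : Injective _≡_ _≡_ c′
  c′-inj = rotate-injective i ∘ proj₁ hole
  at₀ : ∀ {x} → Adj G (c i) x → Adj G (c′ (# 0)) x
  at₀ {x} = subst (λ k → Adj G (c k) x) (sym (rotate-zero i))
  at₁ : ∀ {x} → Adj G (c j) x → Adj G (c′ (# 1)) x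
  at₁ {x} = subst (λ k → Adj G (c k) x) (sym (rotate-consec i j i→j))
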